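{- Let $V$ be a finite set of size $v$ and let $(\mathfrak{P}_0,\ldots,\mathfrak{P}_v)$ be a tactical sequence of partitions on $V$. Let $(V,\mathcal{D})$ be a non-empty $t$-$(v,k,\lambda)$ design with $t\leq k\leq v-t$, such that the block set has the form $\mathcal{D}=\bigcup\mathfrak{B}$ with $\mathfrak{B}\subseteq\mathfrak{P}_k$. Then $\#\mathfrak{B}\geq\#\mathfrak{P}_x$ for all $x\in\{0,\ldots,\lfloor t/2\rfloor\}$.
   Context: $\binom{V}{x}$ is the set of $x$-subsets of $V$; each $\mathfrak{P}_x$ is a partition of $\binom{V}{x}$. $(\mathfrak{P}_0,\ldots,\mathfrak{P}_v)$ is a tactical sequence of partitions if for all $x\le y$ and all parts $\mathcal{X}\in\mathfrak{P}_x,\mathcal{Y}\in\mathfrak{P}_y$, the number $\#\{Y\in\mathcal{Y}\mid X\subseteq Y\}$ does not depend on $X\in\mathcal{X}$ and $\#\{X\in\mathcal{X}\mid X\subseteq Y\}$ does not depend on $Y\in\mathcal{Y}$ (e.g. the orbit partitions of a permutation group on $V$ acting on $x$-subsets). A $t$-$(v,k,\lambda)$ design $(V,\mathcal{D})$ is a set $\mathcal{D}$ of $k$-subsets (blocks) of $V$ such that every $t$-subset of $V$ lies in exactly $\lambda$ blocks; $\mathfrak{B}$ is a set of parts of $\mathfrak{P}_k$ whose union is $\mathcal{D}$. -}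

module Defs where

open import Data.Nat using (ℕ; zero; suc; _≤_; _≟_)
open import Data.Bool using (Bool; _∧_)
open import Data.Fin using (Fin)
import Data.Fin as F
open import Data.Fin.Subset using (Subset; ∣_∣; _⊆_; _∈_; inside; outside)
open import Data.Fin.Subset.Properties using (_⊆?_; _∈?_)
open import Data.List using (List; []; _∷_; map; _++_; length; filterᵇ)
open import Data.Vec using (_∷_; [])
open import Data.Product using (Σ; _×_; ∃)
open import Relation.Nullary using (does)
open import Relation.Binary.PropositionalEquality using (_≡_)

-- All subsets of Fin n (as characteristic vectors), each exactly once.
allSubsets : (n : ℕ) → List (Subset n)
allSubsets zero = [] ∷ []
allSubsets (suc n) = map (outside ∷_) (allSubsets n) ++ map (inside ∷_) (allSubsets n)

count : {n : ℕ} → (Subset n → Bool) → ℕ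
count {n} p = length (filterᵇ p (allSubsets n))

-- A sequence of partitions (𝔓_x) of the x-subsets of V = Fin v.
-- 𝔓_x has  parts x  parts, labelled by Fin (parts x); cls x S is the part
-- containing the x-subset S (its value on non-x-subsets is irrelevant).
-- Every part is non-empty (surj), so #𝔓_x = parts x.
record PartitionSeq (v : ℕ) : Set where
  field
    parts : ℕ → ℕ
    cls   : (x : ℕ) → Subset v → Fin (parts x)
    surj  : (x : ℕ) → x ≤ v → (i : Fin (parts x)) →
            ∃ λ (S : Subset v) → ∣ S ∣ ≡ x × cls x S ≡ i

  upCount : (y : ℕ) → Fin (parts y) → Subset v → ℕ
  upCount y j X = count (λ Y → does (∣ Y ∣ ≟ y) ∧ (does (cls y Y F.≟ j) ∧ does (X ⊆? Y)))

  downCount : (x : ℕ) → Fin (parts x) → Subset v → ℕ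
  downCount x i Y = count (λ X → does (∣ X ∣ ≟ x) ∧ (does (cls x X F.≟ i) ∧ does (X ⊆? Y)))

open PartitionSeq public

record Tactical {v : ℕ} (P : PartitionSeq v) : Set where
  field
    up   : (x y : ℕ) → x ≤ y → y ≤ v → (i : Fin (parts P x)) (j : Fin (parts P y)) →
           (X X' : Subset v) → ∣ X ∣ ≡ x → ∣ X' ∣ ≡ x → cls P x X ≡ i → cls P x X' ≡ i →
           upCount P y j X ≡ upCount P y j X'
    down : (x y : ℕ) → x ≤ y → y ≤ v → (i : Fin (parts P x)) (j : Fin (parts P y)) →
           (Y Y' : Subset v) → ∣ Y ∣ ≡ y → ∣ Y' ∣ ≡ y → cls P y Y ≡ j → cls P y Y' ≡ j →
           downCount P x i Y ≡ downCount P x i Y'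

-- The block set 𝒟 = ⋃ 𝔅 with 𝔅 ⊆ 𝔓_k (𝔅 given as a subset of the part labels).
IsBlock : {v : ℕ} (P : PartitionSeq v) (k : ℕ) (𝔅 : Subset (parts P k)) → Subset v → Bool
IsBlock P k 𝔅 Y = does (∣ Y ∣ ≟ k) ∧ does (cls P k Y ∈? 𝔅)

IsDesign : {v : ℕ} (P : PartitionSeq v) (t k λ' : ℕ) (𝔅 : Subset (parts P k)) → Set
IsDesign {v} P t k λ' 𝔅 = (T : Subset v) → ∣ T ∣ ≡ t →
  count (λ Y → IsBlock P k 𝔅 Y ∧ does (T ⊆? Y)) ≡ λ'

-- Suppose ∣ 𝔅 ∣ < #𝔓ₓ. By tacticality the number of x-subsets of a block B lying in a
-- given part of 𝔓ₓ depends only on the part of 𝔓ₖ containing B, so asking that the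
-- x-subsets of every block carry total weight 0 imposes at most ∣ 𝔅 ∣ linear conditions
-- on weights y indexed by 𝔓ₓ, and some integer vector y ≠ 0 satisfies them all.
-- Lift y to f(S) = y(part of S) on x-subsets; then Σ_B (Σ_{S ⊆ B} f S)² = 0.
-- As the design has strength t ≥ 2x, the number of blocks through S ∪ S′ for x-sets
-- S, S′ is Σ_{I ⊆ S ∩ S′} μ(∣ I ∣), where μ(i) counts the blocks containing a given
-- (2x − i)-set and missing a disjoint i-set; by inclusion–exclusion over λ₀, …, λₜ it
-- does not depend on the sets. Hence 0 = Σ_I μ(∣ I ∣) (Σ_{S ⊇ I} f S)², a sum of
-- non-negative terms, and for ∣ I ∣ = x the term is μ(x) f(I)² with μ(x) > 0, since
-- k ≤ v − t leaves room for an x-set outside a block. So f = 0, contradicting y ≠ 0.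

module Submission where

open import Defs
open import Data.Nat using (ℕ; _≤_; _∸_; _/_)
open import Data.Bool using (T)
open import Data.Fin.Subset using (Subset; ∣_∣)
open import Data.Product using (∃)

open import Data.Nat using (zero; suc; z≤n; s≤s; _<_; _≡ᵇ_)
import Data.Nat as ℕ
import Data.Nat.Properties as ℕₚ
open import Data.Nat.Combinatorics using (nCk+nC[k+1]≡[n+1]C[k+1]) renaming (_C_ to _choose_)
open import Data.Nat.DivMod using (m/n*n≤m)
open import Data.Bool using (Bool; true; false; _∧_; T?)
open import Data.Bool.Properties using (T-≡)
open import Data.Integer using (ℤ; +_; -[1+_]; 0ℤ; 1ℤ; _+_; _*_; -_; _-_; _^_; +≤+)
import Data.Integer as ℤ
import Data.Integer.Properties as ℤₚ
open import Data.Integer.Tactic.RingSolver using (solve-∀)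
open import Data.Fin using (Fin; zero; suc)
import Data.Fin as Fin
open import Data.Fin.Subset using (inside; outside; ⊤; ⊥; ∁; _∪_; _∩_; _─_)
open import Data.Fin.Subset.Properties using (_⊆?_; _∈?_; ∣⊥∣≡0; ∣⊤∣≡n; ∣∁p∣≡n∸∣p∣)
open import Data.List using (List; []; _∷_; map; _++_; length; filterᵇ)
open import Data.List.Properties using (filter-++; length-++; length-map)
open import Data.List.Membership.Propositional using (_∈_)
open import Data.List.Membership.Propositional.Properties using (∈-map⁺)
open import Data.List.Relation.Unary.Any using (here; there)
open import Data.List.Relation.Unary.All as All using (All; []; _∷_)
open import Data.List.Relation.Unary.All.Properties using (map⁻)
open import Data.Product using (∃-syntax; _×_; _,_; proj₁; proj₂)
open import Data.Sum using (inj₁; inj₂; [_,_]′)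
open import Data.Unit using (tt)
open import Data.Vec using ([]; _∷_)
open import Data.Vec.Functional using (Vector)
open import Data.Empty using (⊥-elim)
open import Function using (_∘_; id; case_of_)
open import Function.Bundles using (Equivalence)
open import Relation.Nullary using (¬_; does; yes; no)
open import Relation.Nullary.Decidable using (dec-true; dec-false)
open import Relation.Binary.PropositionalEquality
  using (_≡_; _≢_; refl; sym; trans; cong; cong₂; subst; module ≡-Reasoning)
open import Algebra.Properties.Semiring.Sum ℤₚ.+-*-semiring
  using (sum; sum-cong-≗; sum-replicate-zero; *-distribˡ-sum)
  renaming (∑-distrib-+ to sum-distrib-+)

private
  variable
    n m : ℕ

𝟙 : Bool → ℤ
𝟙 true  = 1ℤ
𝟙 false = 0ℤ

𝟙-∧ : ∀ a b → 𝟙 (a ∧ b) ≡ 𝟙 a * 𝟙 b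
𝟙-∧ true  b = sym (ℤₚ.*-identityˡ (𝟙 b))
𝟙-∧ false b = refl

0≤𝟙 : ∀ a → 0ℤ ℤ.≤ 𝟙 a
0≤𝟙 true  = +≤+ z≤n
0≤𝟙 false = +≤+ z≤n

0≤* : ∀ {i j} → 0ℤ ℤ.≤ i → 0ℤ ℤ.≤ j → 0ℤ ℤ.≤ i * j
0≤* {+ m} {+ n} _ _ = subst (0ℤ ℤ.≤_) (ℤₚ.pos-* m n) (+≤+ z≤n)

0≤i*i : ∀ i → 0ℤ ℤ.≤ i * i
0≤i*i (+ n)    = 0≤* {+ n} {+ n} (+≤+ z≤n) (+≤+ z≤n)
0≤i*i -[1+ n ] = +≤+ z≤n

i*[j*j]≡0⇒j≡0 : ∀ {i j} → i ≢ 0ℤ → i * (j * j) ≡ 0ℤ → j ≡ 0ℤ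
i*[j*j]≡0⇒j≡0 {i} {j} i≢0 eq with ℤₚ.i*j≡0⇒i≡0∨j≡0 i eq
... | inj₁ i≡0   = ⊥-elim (i≢0 i≡0)
... | inj₂ j*j≡0 = [ id , id ]′ (ℤₚ.i*j≡0⇒i≡0∨j≡0 j j*j≡0)

-- Opaque, so that unification can read the summand off a sum ∑ f.
opaque
  ∑ : (Subset n → ℤ) → ℤ
  ∑ {zero}  f = f []
  ∑ {suc n} f = ∑ (λ S → f (outside ∷ S)) + ∑ (λ S → f (inside ∷ S))

  ∑-suc : (f : Subset (suc n) → ℤ) → ∑ f ≡ ∑ (λ S → f (outside ∷ S)) + ∑ (λ S → f (inside ∷ S))
  ∑-suc f = refl

  ∑-nil : (f : Subset zero → ℤ) → ∑ f ≡ f []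
  ∑-nil f = refl

  ∑-cong : {f g : Subset n → ℤ} → (∀ S → f S ≡ g S) → ∑ f ≡ ∑ g
  ∑-cong {zero}  f≡g = f≡g []
  ∑-cong {suc n} f≡g = cong₂ _+_ (∑-cong (f≡g ∘ (outside ∷_))) (∑-cong (f≡g ∘ (inside ∷_)))

  ∑-zero : {f : Subset n → ℤ} → (∀ S → f S ≡ 0ℤ) → ∑ f ≡ 0ℤ
  ∑-zero {zero}  f≡0 = f≡0 []
  ∑-zero {suc n} f≡0 = cong₂ _+_ (∑-zero (f≡0 ∘ (outside ∷_))) (∑-zero (f≡0 ∘ (inside ∷_)))

  ∑-distrib-+ : ∀ (f g : Subset n → ℤ) → ∑ (λ S → f S + g S) ≡ ∑ f + ∑ g
  ∑-distrib-+ {zero}  f g = refl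
  ∑-distrib-+ {suc n} f g = trans
    (cong₂ _+_ (∑-distrib-+ (f ∘ (outside ∷_)) (g ∘ (outside ∷_)))
               (∑-distrib-+ (f ∘ (inside ∷_)) (g ∘ (inside ∷_))))
    (interchange (∑ (f ∘ (outside ∷_))) (∑ (g ∘ (outside ∷_))) (∑ (f ∘ (inside ∷_))) (∑ (g ∘ (inside ∷_))))
    where
    interchange : ∀ a b c d → (a + b) + (c + d) ≡ (a + c) + (b + d)
    interchange = solve-∀

  *-distribˡ-∑ : ∀ c (f : Subset n → ℤ) → c * ∑ f ≡ ∑ (λ S → c * f S)
  *-distribˡ-∑ {zero}  c f = refl
  *-distribˡ-∑ {suc n} c f = trans (ℤₚ.*-distribˡ-+ c _ _)
    (cong₂ _+_ (*-distribˡ-∑ c (f ∘ (outside ∷_))) (*-distribˡ-∑ c (f ∘ (inside ∷_))))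

  ∑-comm : ∀ (h : Subset n → Subset m → ℤ) →
           ∑ (λ S → ∑ (λ S' → h S S')) ≡ ∑ (λ S' → ∑ (λ S → h S S'))
  ∑-comm {zero}  h = refl
  ∑-comm {suc n} h = trans
    (cong₂ _+_ (∑-comm (h ∘ (outside ∷_))) (∑-comm (h ∘ (inside ∷_))))
    (sym (∑-distrib-+ (λ S' → ∑ (λ S → h (outside ∷ S) S')) (λ S' → ∑ (λ S → h (inside ∷ S) S'))))

*-distribʳ-∑ : ∀ c (f : Subset n → ℤ) → ∑ f * c ≡ ∑ (λ S → f S * c)
*-distribʳ-∑ c f = trans (ℤₚ.*-comm (∑ f) c)
  (trans (*-distribˡ-∑ c f) (∑-cong (λ S → ℤₚ.*-comm c (f S))))

∑-sum-comm : ∀ (h : Subset n → Fin m → ℤ) →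
             ∑ (λ S → sum (h S)) ≡ sum (λ i → ∑ (λ S → h S i))
∑-sum-comm {m = zero} h = ∑-zero (λ _ → refl)
∑-sum-comm {m = suc m} h = trans
  (∑-distrib-+ (λ S → h S zero) (λ S → sum (λ i → h S (suc i))))
  (cong (λ z → ∑ (λ S → h S zero) + z) (∑-sum-comm (λ S i → h S (suc i))))

∑*∑ : ∀ (f : Subset n → ℤ) (g : Subset m → ℤ) → ∑ f * ∑ g ≡ ∑ (λ S → ∑ (λ S' → f S * g S'))
∑*∑ f g = trans (*-distribʳ-∑ (∑ g) f) (∑-cong (λ S → *-distribˡ-∑ (f S) g))

0≤∑ : {f : Subset n → ℤ} → (∀ S → 0ℤ ℤ.≤ f S) → 0ℤ ℤ.≤ ∑ f
0≤∑ {zero}  {f} 0≤f = subst (0ℤ ℤ.≤_) (sym (∑-nil f)) (0≤f [])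
0≤∑ {suc n} {f} 0≤f = subst (0ℤ ℤ.≤_) (sym (∑-suc f))
  (ℤₚ.+-mono-≤ (0≤∑ (0≤f ∘ (outside ∷_))) (0≤∑ (0≤f ∘ (inside ∷_))))

≤∑ : {f : Subset n → ℤ} → (∀ S → 0ℤ ℤ.≤ f S) → ∀ S → f S ℤ.≤ ∑ f
≤∑ {zero}  {f} 0≤f [] = ℤₚ.≤-reflexive (sym (∑-nil f))
≤∑ {suc n} {f} 0≤f (outside ∷ S) = subst (f (outside ∷ S) ℤ.≤_) (sym (∑-suc f))
  (ℤₚ.≤-trans (ℤₚ.≤-reflexive (sym (ℤₚ.+-identityʳ _)))
              (ℤₚ.+-mono-≤ (≤∑ (0≤f ∘ (outside ∷_)) S) (0≤∑ (0≤f ∘ (inside ∷_)))))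
≤∑ {suc n} {f} 0≤f (inside ∷ S) = subst (f (inside ∷ S) ℤ.≤_) (sym (∑-suc f))
  (ℤₚ.≤-trans (ℤₚ.≤-reflexive (sym (ℤₚ.+-identityˡ _)))
              (ℤₚ.+-mono-≤ (0≤∑ (0≤f ∘ (outside ∷_))) (≤∑ (0≤f ∘ (inside ∷_)) S)))

∑≡0⇒≡0 : {f : Subset n → ℤ} → (∀ S → 0ℤ ℤ.≤ f S) → ∑ f ≡ 0ℤ → ∀ S → f S ≡ 0ℤ
∑≡0⇒≡0 0≤f ∑f≡0 S = ℤₚ.≤-antisym (subst (_ ℤ.≤_) ∑f≡0 (≤∑ 0≤f S)) (0≤f S)

∑-weighted-squares : ∀ (w : Subset n → ℤ) (p : Subset n → Subset m → ℤ) (f : Subset m → ℤ) →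
  ∑ (λ a → w a * (∑ (λ b → p a b * f b) * ∑ (λ b → p a b * f b)))
  ≡ ∑ (λ b → ∑ (λ b' → f b * f b' * ∑ (λ a → w a * (p a b * p a b'))))
∑-weighted-squares w p f = begin
  ∑ (λ a → w a * (∑ (λ b → p a b * f b) * ∑ (λ b → p a b * f b)))
    ≡⟨ ∑-cong (λ a → trans (cong (w a *_) (∑*∑ _ _))
                       (trans (*-distribˡ-∑ (w a) _) (∑-cong (λ b → *-distribˡ-∑ (w a) _)))) ⟩
  ∑ (λ a → ∑ (λ b → ∑ (λ b' → w a * (p a b * f b * (p a b' * f b')))))
    ≡⟨ ∑-comm _ ⟩
  ∑ (λ b → ∑ (λ a → ∑ (λ b' → w a * (p a b * f b * (p a b' * f b')))))
    ≡⟨ ∑-cong (λ b → ∑-comm _) ⟩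
  ∑ (λ b → ∑ (λ b' → ∑ (λ a → w a * (p a b * f b * (p a b' * f b')))))
    ≡⟨ ∑-cong (λ b → ∑-cong (λ b' → trans (∑-cong (λ a → regroup (w a) (p a b) (f b) (p a b') (f b')))
                                         (sym (*-distribˡ-∑ (f b * f b') _)))) ⟩
  ∑ (λ b → ∑ (λ b' → f b * f b' * ∑ (λ a → w a * (p a b * p a b')))) ∎
  where
  open ≡-Reasoning
  regroup : ∀ w x y z u → w * (x * y * (z * u)) ≡ y * u * (w * (x * z))
  regroup = solve-∀

length-filterᵇ-map : ∀ {A B : Set} (p : B → Bool) (h : A → B) (xs : List A) →
                     length (filterᵇ p (map h xs)) ≡ length (filterᵇ (p ∘ h) xs)
length-filterᵇ-map p h []       = refl
length-filterᵇ-map p h (x ∷ xs) with p (h x)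
... | true  = cong suc (length-filterᵇ-map p h xs)
... | false = length-filterᵇ-map p h xs

length-filterᵇ-++ : ∀ {A : Set} (p : A → Bool) (xs ys : List A) →
  length (filterᵇ p (xs ++ ys)) ≡ length (filterᵇ p xs) ℕ.+ length (filterᵇ p ys)
length-filterᵇ-++ p xs ys = trans (cong length (filter-++ (T? ∘ p) xs ys)) (length-++ (filterᵇ p xs))

count≡∑ : ∀ (p : Subset n → Bool) → + count p ≡ ∑ (𝟙 ∘ p)
count≡∑ {zero}  p rewrite ∑-nil (𝟙 ∘ p) with p []
... | true  = refl
... | false = refl
count≡∑ {suc n} p = begin
  + count p
    ≡⟨ cong +_ (trans (length-filterᵇ-++ p (map (outside ∷_) subsets) (map (inside ∷_) subsets))
                      (cong₂ ℕ._+_ (length-filterᵇ-map p (outside ∷_) subsets)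
                                   (length-filterᵇ-map p (inside ∷_) subsets))) ⟩
  + count (p ∘ (outside ∷_)) + + count (p ∘ (inside ∷_))
    ≡⟨ cong₂ _+_ (count≡∑ (p ∘ (outside ∷_))) (count≡∑ (p ∘ (inside ∷_))) ⟩
  ∑ (𝟙 ∘ p ∘ (outside ∷_)) + ∑ (𝟙 ∘ p ∘ (inside ∷_))
    ≡⟨ ∑-suc (𝟙 ∘ p) ⟨
  ∑ (𝟙 ∘ p) ∎
  where
  open ≡-Reasoning
  subsets = allSubsets n

infix 4.5 _⊆ᵇ_

_⊆ᵇ_ : Subset n → Subset n → Bool
X ⊆ᵇ Y = does (X ⊆? Y)

⊆ᵇ-trans : (X Y Z : Subset n) → X ⊆ᵇ Y ≡ true → Y ⊆ᵇ Z ≡ true → X ⊆ᵇ Z ≡ true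
⊆ᵇ-trans []            []            []            _   _   = refl
⊆ᵇ-trans (outside ∷ X) (outside ∷ Y) (_       ∷ Z) X⊆Y Y⊆Z = ⊆ᵇ-trans X Y Z X⊆Y Y⊆Z
⊆ᵇ-trans (outside ∷ X) (inside  ∷ Y) (inside  ∷ Z) X⊆Y Y⊆Z = ⊆ᵇ-trans X Y Z X⊆Y Y⊆Z
⊆ᵇ-trans (inside  ∷ X) (inside  ∷ Y) (inside  ∷ Z) X⊆Y Y⊆Z = ⊆ᵇ-trans X Y Z X⊆Y Y⊆Z
⊆ᵇ-trans (outside ∷ X) (inside  ∷ Y) (outside ∷ Z) _   ()
⊆ᵇ-trans (inside  ∷ X) (outside ∷ Y) _             ()  _
⊆ᵇ-trans (inside  ∷ X) (inside  ∷ Y) (outside ∷ Z) _   ()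

⊆ᵇ-⊤ : (X : Subset n) → X ⊆ᵇ ⊤ ≡ true
⊆ᵇ-⊤ []            = refl
⊆ᵇ-⊤ (outside ∷ X) = ⊆ᵇ-⊤ X
⊆ᵇ-⊤ (inside  ∷ X) = ⊆ᵇ-⊤ X

⊥-⊆ᵇ : (X : Subset n) → ⊥ ⊆ᵇ X ≡ true
⊥-⊆ᵇ []      = refl
⊥-⊆ᵇ (_ ∷ X) = ⊥-⊆ᵇ X

∪-⊆ᵇ : (X Y Z : Subset n) → X ∪ Y ⊆ᵇ Z ≡ (X ⊆ᵇ Z) ∧ (Y ⊆ᵇ Z)
∪-⊆ᵇ []            []            []            = refl
∪-⊆ᵇ (outside ∷ X) (outside ∷ Y) (_       ∷ Z) = ∪-⊆ᵇ X Y Z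
∪-⊆ᵇ (outside ∷ X) (inside  ∷ Y) (inside  ∷ Z) = ∪-⊆ᵇ X Y Z
∪-⊆ᵇ (outside ∷ X) (inside  ∷ Y) (outside ∷ Z) with X ⊆ᵇ Z
... | true  = refl
... | false = refl
∪-⊆ᵇ (inside  ∷ X) (_       ∷ Y) (outside ∷ Z) = refl
∪-⊆ᵇ (inside  ∷ X) (outside ∷ Y) (inside  ∷ Z) = ∪-⊆ᵇ X Y Z
∪-⊆ᵇ (inside  ∷ X) (inside  ∷ Y) (inside  ∷ Z) = ∪-⊆ᵇ X Y Z

⊆ᵇ-∩ : (X Y Z : Subset n) → X ⊆ᵇ Y ∩ Z ≡ (X ⊆ᵇ Y) ∧ (X ⊆ᵇ Z)
⊆ᵇ-∩ []            []            []            = refl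
⊆ᵇ-∩ (outside ∷ X) (_       ∷ Y) (_       ∷ Z) = ⊆ᵇ-∩ X Y Z
⊆ᵇ-∩ (inside  ∷ X) (outside ∷ Y) (_       ∷ Z) = refl
⊆ᵇ-∩ (inside  ∷ X) (inside  ∷ Y) (inside  ∷ Z) = ⊆ᵇ-∩ X Y Z
⊆ᵇ-∩ (inside  ∷ X) (inside  ∷ Y) (outside ∷ Z) with X ⊆ᵇ Y
... | true  = refl
... | false = refl

─-⊆ᵇ : (X Y : Subset n) → X ─ Y ⊆ᵇ X ≡ true
─-⊆ᵇ []            []            = refl
─-⊆ᵇ (outside ∷ X) (outside ∷ Y) = ─-⊆ᵇ X Y
─-⊆ᵇ (outside ∷ X) (inside  ∷ Y) = ─-⊆ᵇ X Y
─-⊆ᵇ (inside  ∷ X) (outside ∷ Y) = ─-⊆ᵇ X Y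
─-⊆ᵇ (inside  ∷ X) (inside  ∷ Y) = ─-⊆ᵇ X Y

─-⊆ᵇ∁ : (X Y : Subset n) → X ─ Y ⊆ᵇ ∁ Y ≡ true
─-⊆ᵇ∁ []            []            = refl
─-⊆ᵇ∁ (outside ∷ X) (inside  ∷ Y) = ─-⊆ᵇ∁ X Y
─-⊆ᵇ∁ (inside  ∷ X) (inside  ∷ Y) = ─-⊆ᵇ∁ X Y
─-⊆ᵇ∁ (outside ∷ X) (outside ∷ Y) = ─-⊆ᵇ∁ X Y
─-⊆ᵇ∁ (inside  ∷ X) (outside ∷ Y) = ─-⊆ᵇ∁ X Y

⊆ᵇ∁-sym : (X Y : Subset n) → X ⊆ᵇ ∁ Y ≡ true → Y ⊆ᵇ ∁ X ≡ true
⊆ᵇ∁-sym []            []            _ = refl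
⊆ᵇ∁-sym (outside ∷ X) (outside ∷ Y) d = ⊆ᵇ∁-sym X Y d
⊆ᵇ∁-sym (outside ∷ X) (inside  ∷ Y) d = ⊆ᵇ∁-sym X Y d
⊆ᵇ∁-sym (inside  ∷ X) (outside ∷ Y) d = ⊆ᵇ∁-sym X Y d
⊆ᵇ∁-sym (inside  ∷ X) (inside  ∷ Y) ()

⊆ᵇ∁-antitone : (X Y Z : Subset n) → X ⊆ᵇ ∁ Y ≡ true → Z ⊆ᵇ Y ≡ true → X ⊆ᵇ ∁ Z ≡ true
⊆ᵇ∁-antitone X Y Z X#Y Z⊆Y = ⊆ᵇ-trans X (∁ Y) (∁ Z) X#Y (∁-antitone Y Z Z⊆Y)
  where
  ∁-antitone : (Y Z : Subset n) → Z ⊆ᵇ Y ≡ true → ∁ Y ⊆ᵇ ∁ Z ≡ true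
  ∁-antitone []            []            _ = refl
  ∁-antitone (outside ∷ Y) (outside ∷ Z) e = ∁-antitone Y Z e
  ∁-antitone (inside  ∷ Y) (outside ∷ Z) e = ∁-antitone Y Z e
  ∁-antitone (inside  ∷ Y) (inside  ∷ Z) e = ∁-antitone Y Z e
  ∁-antitone (outside ∷ Y) (inside  ∷ Z) ()

∣∣-mono : (X Y : Subset n) → X ⊆ᵇ Y ≡ true → ∣ X ∣ ≤ ∣ Y ∣
∣∣-mono []            []            _   = z≤n
∣∣-mono (outside ∷ X) (outside ∷ Y) X⊆Y = ∣∣-mono X Y X⊆Y
∣∣-mono (outside ∷ X) (inside  ∷ Y) X⊆Y = ℕₚ.m≤n⇒m≤1+n (∣∣-mono X Y X⊆Y)
∣∣-mono (inside  ∷ X) (inside  ∷ Y) X⊆Y = s≤s (∣∣-mono X Y X⊆Y)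
∣∣-mono (inside  ∷ X) (outside ∷ Y) ()

∣∪∣+∣∩∣ : (X Y : Subset n) → ∣ X ∪ Y ∣ ℕ.+ ∣ X ∩ Y ∣ ≡ ∣ X ∣ ℕ.+ ∣ Y ∣
∣∪∣+∣∩∣ []            []            = refl
∣∪∣+∣∩∣ (outside ∷ X) (outside ∷ Y) = ∣∪∣+∣∩∣ X Y
∣∪∣+∣∩∣ (outside ∷ X) (inside  ∷ Y) = trans (cong suc (∣∪∣+∣∩∣ X Y)) (sym (ℕₚ.+-suc _ _))
∣∪∣+∣∩∣ (inside  ∷ X) (outside ∷ Y) = cong suc (∣∪∣+∣∩∣ X Y)
∣∪∣+∣∩∣ (inside  ∷ X) (inside  ∷ Y) =
  cong suc (trans (ℕₚ.+-suc _ _) (trans (cong suc (∣∪∣+∣∩∣ X Y)) (sym (ℕₚ.+-suc _ _))))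

∣∪∣-disjoint : (X Y : Subset n) → X ⊆ᵇ ∁ Y ≡ true → ∣ X ∪ Y ∣ ≡ ∣ X ∣ ℕ.+ ∣ Y ∣
∣∪∣-disjoint []            []            _ = refl
∣∪∣-disjoint (outside ∷ X) (outside ∷ Y) d = ∣∪∣-disjoint X Y d
∣∪∣-disjoint (outside ∷ X) (inside  ∷ Y) d = trans (cong suc (∣∪∣-disjoint X Y d)) (sym (ℕₚ.+-suc _ _))
∣∪∣-disjoint (inside  ∷ X) (outside ∷ Y) d = cong suc (∣∪∣-disjoint X Y d)
∣∪∣-disjoint (inside  ∷ X) (inside  ∷ Y) ()

∣─∣+∣∣ : (X Y : Subset n) → Y ⊆ᵇ X ≡ true → ∣ X ─ Y ∣ ℕ.+ ∣ Y ∣ ≡ ∣ X ∣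
∣─∣+∣∣ []            []            _   = refl
∣─∣+∣∣ (outside ∷ X) (outside ∷ Y) Y⊆X = ∣─∣+∣∣ X Y Y⊆X
∣─∣+∣∣ (inside  ∷ X) (outside ∷ Y) Y⊆X = cong suc (∣─∣+∣∣ X Y Y⊆X)
∣─∣+∣∣ (inside  ∷ X) (inside  ∷ Y) Y⊆X = trans (ℕₚ.+-suc _ _) (cong suc (∣─∣+∣∣ X Y Y⊆X))
∣─∣+∣∣ (outside ∷ X) (inside  ∷ Y) ()

-- A canonical m-subset of X; all of X when ∣ X ∣ < m.
keepFirst : ℕ → Subset n → Subset n
keepFirst zero    X             = ⊥
keepFirst (suc m) []            = []
keepFirst (suc m) (outside ∷ X) = outside ∷ keepFirst (suc m) X
keepFirst (suc m) (inside  ∷ X) = inside  ∷ keepFirst m X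

keepFirst-⊆ᵇ : ∀ m (X : Subset n) → keepFirst m X ⊆ᵇ X ≡ true
keepFirst-⊆ᵇ zero    X             = ⊥-⊆ᵇ X
keepFirst-⊆ᵇ (suc m) []            = refl
keepFirst-⊆ᵇ (suc m) (outside ∷ X) = keepFirst-⊆ᵇ (suc m) X
keepFirst-⊆ᵇ (suc m) (inside  ∷ X) = keepFirst-⊆ᵇ m X

∣keepFirst∣ : ∀ m (X : Subset n) → m ≤ ∣ X ∣ → ∣ keepFirst m X ∣ ≡ m
∣keepFirst∣ {n} zero X _                   = ∣⊥∣≡0 n
∣keepFirst∣ (suc m) (outside ∷ X) m<∣X∣   = ∣keepFirst∣ (suc m) X m<∣X∣
∣keepFirst∣ (suc m) (inside  ∷ X) (s≤s m≤∣X∣) = cong suc (∣keepFirst∣ m X m≤∣X∣)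

-- binomialTransform φ j = Σᵢ (j choose i) φ(i)
binomialTransform : (ℕ → ℤ) → ℕ → ℤ
binomialTransform φ zero    = φ 0
binomialTransform φ (suc j) = binomialTransform φ j + binomialTransform (φ ∘ suc) j

∑-⊆-by-size : ∀ (X : Subset n) (φ : ℕ → ℤ) →
              ∑ (λ L → 𝟙 (L ⊆ᵇ X) * φ ∣ L ∣) ≡ binomialTransform φ ∣ X ∣
∑-⊆-by-size []            φ = trans (∑-nil _) (ℤₚ.*-identityˡ (φ 0))
∑-⊆-by-size (outside ∷ X) φ = trans (∑-suc _)
  (trans (cong₂ _+_ (∑-⊆-by-size X φ) (∑-zero (λ _ → refl))) (ℤₚ.+-identityʳ _))
∑-⊆-by-size (inside  ∷ X) φ =
  trans (∑-suc _) (cong₂ _+_ (∑-⊆-by-size X φ) (∑-⊆-by-size X (φ ∘ suc)))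

∑-⊇-concentrated : ∀ {s} (f : Subset n → ℤ) → (∀ S → ∣ S ∣ ≢ s → f S ≡ 0ℤ) →
                   ∀ I → ∣ I ∣ ≡ s → ∑ (λ S → 𝟙 (I ⊆ᵇ S) * f S) ≡ f I
∑-⊇-concentrated f _ [] refl = trans (∑-nil _) (ℤₚ.*-identityˡ (f []))
∑-⊇-concentrated f off (outside ∷ I) refl = trans (∑-suc _)
  (trans (cong₂ _+_ (∑-⊇-concentrated (f ∘ (outside ∷_)) (off ∘ (outside ∷_)) I refl)
                    (∑-zero larger-vanishes))
         (ℤₚ.+-identityʳ _))
  where
  larger-vanishes : ∀ S → 𝟙 (I ⊆ᵇ S) * f (inside ∷ S) ≡ 0ℤ
  larger-vanishes S with I ⊆ᵇ S in I⊆S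
  ... | false = refl
  ... | true  = trans (ℤₚ.*-identityˡ _)
    (off (inside ∷ S) (λ eq → ℕₚ.<-irrefl (sym eq) (s≤s (∣∣-mono I S I⊆S))))
∑-⊇-concentrated f off (inside ∷ I) refl = trans (∑-suc _)
  (trans (cong₂ _+_ (∑-zero (λ _ → refl))
                    (∑-⊇-concentrated (f ∘ (inside ∷_)) (λ S ne → off (inside ∷ S) (ne ∘ ℕₚ.suc-injective)) I refl))
         (ℤₚ.+-identityˡ _))

∑-interval-of-width : ∀ (U X : Subset n) d m → U ⊆ᵇ X ≡ true → ∣ X ∣ ≡ ∣ U ∣ ℕ.+ d →
  ∑ (λ Y → 𝟙 (∣ Y ∣ ≡ᵇ ∣ U ∣ ℕ.+ m) * (𝟙 (U ⊆ᵇ Y) * 𝟙 (Y ⊆ᵇ X))) ≡ + (d choose m)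
∑-interval-of-width []            []            zero    zero    _   _ = ∑-nil _
∑-interval-of-width []            []            zero    (suc m) _   _ = ∑-nil _
∑-interval-of-width (outside ∷ U) (outside ∷ X) d       m       U⊆X eq = trans (∑-suc _)
  (trans (cong₂ _+_ (∑-interval-of-width U X d m U⊆X eq) (∑-zero (λ Y → no-room Y)))
         (ℤₚ.+-identityʳ _))
  where
  no-room : ∀ Y → 𝟙 (suc ∣ Y ∣ ≡ᵇ ∣ U ∣ ℕ.+ m) * (𝟙 (U ⊆ᵇ Y) * 0ℤ) ≡ 0ℤ
  no-room Y = trans (cong (𝟙 (suc ∣ Y ∣ ≡ᵇ ∣ U ∣ ℕ.+ m) *_) (ℤₚ.*-zeroʳ (𝟙 (U ⊆ᵇ Y))))
                    (ℤₚ.*-zeroʳ (𝟙 (suc ∣ Y ∣ ≡ᵇ ∣ U ∣ ℕ.+ m)))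
∑-interval-of-width (outside ∷ U) (inside ∷ X) zero m U⊆X eq =
  ⊥-elim (ℕₚ.<-irrefl (sym (trans eq (ℕₚ.+-identityʳ _))) (s≤s (∣∣-mono U X U⊆X)))
∑-interval-of-width (outside ∷ U) (inside ∷ X) (suc d) zero U⊆X eq = trans (∑-suc _)
  (trans (cong₂ _+_ (∑-interval-of-width U X d zero U⊆X eq′) (∑-zero too-big))
         (ℤₚ.+-identityʳ _))
  where
  eq′ = ℕₚ.suc-injective (trans eq (ℕₚ.+-suc _ _))
  too-big : ∀ Y → 𝟙 (suc ∣ Y ∣ ≡ᵇ ∣ U ∣ ℕ.+ 0) * (𝟙 (U ⊆ᵇ Y) * 𝟙 (Y ⊆ᵇ X)) ≡ 0ℤ
  too-big Y with U ⊆ᵇ Y in U⊆Y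
  ... | false = ℤₚ.*-zeroʳ (𝟙 (suc ∣ Y ∣ ≡ᵇ ∣ U ∣ ℕ.+ 0))
  ... | true  rewrite ℕₚ.+-identityʳ ∣ U ∣
              | dec-false (suc ∣ Y ∣ ℕ.≟ ∣ U ∣) (λ eq → ℕₚ.<-irrefl (sym eq) (s≤s (∣∣-mono U Y U⊆Y))) = refl
∑-interval-of-width (outside ∷ U) (inside ∷ X) (suc d) (suc m) U⊆X eq = trans (∑-suc _)
  (trans (cong₂ _+_ (∑-interval-of-width U X d (suc m) U⊆X eq′)
                    (trans (∑-cong shift) (∑-interval-of-width U X d m U⊆X eq′)))
         (cong +_ (trans (ℕₚ.+-comm (d choose suc m) (d choose m)) (nCk+nC[k+1]≡[n+1]C[k+1] d m))))
  where
  eq′ = ℕₚ.suc-injective (trans eq (ℕₚ.+-suc _ _))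
  shift : ∀ Y → 𝟙 (suc ∣ Y ∣ ≡ᵇ ∣ U ∣ ℕ.+ suc m) * (𝟙 (U ⊆ᵇ Y) * 𝟙 (Y ⊆ᵇ X))
              ≡ 𝟙 (∣ Y ∣ ≡ᵇ ∣ U ∣ ℕ.+ m) * (𝟙 (U ⊆ᵇ Y) * 𝟙 (Y ⊆ᵇ X))
  shift Y rewrite ℕₚ.+-suc ∣ U ∣ m = refl
∑-interval-of-width (inside ∷ U) (inside ∷ X) d m U⊆X eq = trans (∑-suc _)
  (trans (cong₂ _+_ (∑-zero (λ Y → ℤₚ.*-zeroʳ (𝟙 (∣ Y ∣ ≡ᵇ suc (∣ U ∣ ℕ.+ m))))) (∑-interval-of-width U X d m U⊆X (ℕₚ.suc-injective eq)))
         (ℤₚ.+-identityˡ _))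
∑-interval-of-width (inside ∷ U) (outside ∷ X) d m () _
∑-interval-of-width []            []            (suc d) m       _   ()

∑-⊆-alternating : ∀ (C B : Subset n) →
  ∑ (λ L → 𝟙 (L ⊆ᵇ C) * ((- 1ℤ) ^ ∣ L ∣ * 𝟙 (L ⊆ᵇ B))) ≡ 𝟙 (C ⊆ᵇ ∁ B)
∑-⊆-alternating []            []            = ∑-nil _
∑-⊆-alternating (outside ∷ C) (_ ∷ B)       = trans (∑-suc _)
  (trans (cong₂ _+_ (∑-⊆-alternating C B) (∑-zero (λ _ → refl))) (ℤₚ.+-identityʳ _))
∑-⊆-alternating (inside ∷ C) (outside ∷ B) = trans (∑-suc _)
  (trans (cong₂ _+_ (∑-⊆-alternating C B) (∑-zero (λ L → vanish (𝟙 (L ⊆ᵇ C)) ((- 1ℤ) ^ ∣ L ∣))))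
         (ℤₚ.+-identityʳ _))
  where
  vanish : ∀ a b → a * (- 1ℤ * b * 0ℤ) ≡ 0ℤ
  vanish = solve-∀
∑-⊆-alternating (inside ∷ C) (inside ∷ B) = begin
  ∑ (λ L → 𝟙 (L ⊆ᵇ inside ∷ C) * ((- 1ℤ) ^ ∣ L ∣ * 𝟙 (L ⊆ᵇ inside ∷ B)))
    ≡⟨ ∑-suc _ ⟩
  ∑ term + ∑ (λ L → 𝟙 (L ⊆ᵇ C) * (- 1ℤ * (- 1ℤ) ^ ∣ L ∣ * 𝟙 (L ⊆ᵇ B)))
    ≡⟨ cong (λ x → ∑ term + x) (∑-cong (λ L → sign-out (𝟙 (L ⊆ᵇ C)) ((- 1ℤ) ^ ∣ L ∣) (𝟙 (L ⊆ᵇ B)))) ⟩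
  ∑ term + ∑ (λ L → - 1ℤ * term L)
    ≡⟨ cong (λ x → ∑ term + x) (*-distribˡ-∑ (- 1ℤ) term) ⟨
  ∑ term + - 1ℤ * ∑ term
    ≡⟨ cancel (∑ term) ⟩
  0ℤ ∎
  where
  open ≡-Reasoning
  term : Subset _ → ℤ
  term L = 𝟙 (L ⊆ᵇ C) * ((- 1ℤ) ^ ∣ L ∣ * 𝟙 (L ⊆ᵇ B))
  sign-out : ∀ a b c → a * (- 1ℤ * b * c) ≡ - 1ℤ * (a * (b * c))
  sign-out = solve-∀
  cancel : ∀ x → x + - 1ℤ * x ≡ 0ℤ
  cancel = solve-∀

-- The only such L is J ∩ ∁ B.
∑-⊆-trace : ∀ (J B : Subset n) → ∑ (λ L → 𝟙 (L ⊆ᵇ J) * (𝟙 (J ─ L ⊆ᵇ B) * 𝟙 (L ⊆ᵇ ∁ B))) ≡ 1ℤ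
∑-⊆-trace []            []            = ∑-nil _
∑-⊆-trace (outside ∷ J) (_ ∷ B)       = trans (∑-suc _)
  (trans (cong₂ _+_ (∑-⊆-trace J B) (∑-zero (λ _ → refl))) (ℤₚ.+-identityʳ _))
∑-⊆-trace (inside ∷ J) (inside ∷ B)  = trans (∑-suc _)
  (trans (cong₂ _+_ (∑-⊆-trace J B) (∑-zero (λ L → vanish (𝟙 (L ⊆ᵇ J)) (𝟙 (J ─ L ⊆ᵇ B)))))
         (ℤₚ.+-identityʳ _))
  where
  vanish : ∀ a b → a * (b * 0ℤ) ≡ 0ℤ
  vanish = solve-∀
∑-⊆-trace (inside ∷ J) (outside ∷ B) = trans (∑-suc _)
  (trans (cong₂ _+_ (∑-zero (λ L → ℤₚ.*-zeroʳ (𝟙 (L ⊆ᵇ J)))) (∑-⊆-trace J B))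
         (ℤₚ.+-identityˡ _))

0<choose : ∀ n k → k ≤ n → 0 ℕ.< n choose k
0<choose n       zero    _         = s≤s z≤n
0<choose (suc n) (suc k) (s≤s k≤n) = subst (0 ℕ.<_) (nCk+nC[k+1]≡[n+1]C[k+1] n k)
  (ℕₚ.<-≤-trans (0<choose n k k≤n) (ℕₚ.m≤m+n _ _))

∑-interval : ∀ (U X : Subset n) m →
  ∑ (λ Y → 𝟙 (∣ Y ∣ ≡ᵇ ∣ U ∣ ℕ.+ m) * (𝟙 (U ⊆ᵇ Y) * 𝟙 (Y ⊆ᵇ X)))
  ≡ 𝟙 (U ⊆ᵇ X) * + ((∣ X ∣ ∸ ∣ U ∣) choose m)
∑-interval U X m with U ⊆ᵇ X in U⊆X
... | true  = trans (∑-interval-of-width U X (∣ X ∣ ∸ ∣ U ∣) m U⊆X (sym (ℕₚ.m+[n∸m]≡n (∣∣-mono U X U⊆X))))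
                    (sym (ℤₚ.*-identityˡ _))
... | false = ∑-zero empty-interval
  where
  empty-interval : ∀ Y → 𝟙 (∣ Y ∣ ≡ᵇ ∣ U ∣ ℕ.+ m) * (𝟙 (U ⊆ᵇ Y) * 𝟙 (Y ⊆ᵇ X)) ≡ 0ℤ
  empty-interval Y with U ⊆ᵇ Y in U⊆Y | Y ⊆ᵇ X in Y⊆X
  ... | true  | true  = case trans (sym U⊆X) (⊆ᵇ-trans U Y X U⊆Y Y⊆X) of λ ()
  ... | true  | false = ℤₚ.*-zeroʳ (𝟙 (∣ Y ∣ ≡ᵇ ∣ U ∣ ℕ.+ m))
  ... | false | _     = ℤₚ.*-zeroʳ (𝟙 (∣ Y ∣ ≡ᵇ ∣ U ∣ ℕ.+ m))

infix 7 _·_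

_·_ : Vector ℤ m → Vector ℤ m → ℤ
r · y = sum (λ i → r i * y i)

Solves : List (Vector ℤ m) → Vector ℤ m → Set
Solves rows y = All (λ r → r · y ≡ 0ℤ) rows

data Pivoting {m} : List (Vector ℤ (suc m)) → Set where
  all-vanish : ∀ {rows} → All (λ r → r zero ≡ 0ℤ) rows → Pivoting rows
  pivot      : ∀ {rows} (p : Vector ℤ (suc m)) rest → p zero ≢ 0ℤ →
               length rows ≡ suc (length rest) →
               (∀ y → Solves (p ∷ rest) y → Solves rows y) → Pivoting rows

pivoting : (rows : List (Vector ℤ (suc m))) → Pivoting rows
pivoting []         = all-vanish []
pivoting (r ∷ rows) with r zero ℤₚ.≟ 0ℤ
... | no  r₀≢0 = pivot r rows r₀≢0 refl (λ _ sol → sol)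
... | yes r₀≡0 with pivoting rows
...   | all-vanish vanish = all-vanish (r₀≡0 ∷ vanish)
...   | pivot p rest p₀≢0 len sound =
  pivot p (r ∷ rest) p₀≢0 (cong suc len)
        (λ { y (p·y ∷ r·y ∷ rest·y) → r·y ∷ sound y (p·y ∷ rest·y) })

eliminate : Vector ℤ (suc m) → Vector ℤ (suc m) → Vector ℤ m
eliminate p r j = r (suc j) * p zero - r zero * p (suc j)

backSubstitute : Vector ℤ (suc m) → Vector ℤ m → Vector ℤ (suc m)
backSubstitute p z zero    = - ((λ j → p (suc j)) · z)
backSubstitute p z (suc j) = p zero * z j

eliminate-· : ∀ (p r : Vector ℤ (suc m)) z → eliminate p r · z ≡ r · backSubstitute p z
eliminate-· p r z = begin
  sum (λ j → (r (suc j) * p zero - r zero * p (suc j)) * z j)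
    ≡⟨ sum-cong-≗ (λ j → split (r (suc j)) (p zero) (r zero) (p (suc j)) (z j)) ⟩
  sum (λ j → p zero * (r (suc j) * z j) + (- r zero) * (p (suc j) * z j))
    ≡⟨ sum-distrib-+ (λ j → p zero * (r (suc j) * z j)) (λ j → (- r zero) * (p (suc j) * z j)) ⟩
  sum (λ j → p zero * (r (suc j) * z j)) + sum (λ j → (- r zero) * (p (suc j) * z j))
    ≡⟨ cong₂ _+_ (*-distribˡ-sum (p zero) (λ j → r (suc j) * z j))
                 (*-distribˡ-sum (- r zero) (λ j → p (suc j) * z j)) ⟨
  p zero * R + (- r zero) * P
    ≡⟨ regroup (p zero) R (r zero) P ⟩
  r zero * (- P) + p zero * R
    ≡⟨ cong (λ q → r zero * (- P) + q) (*-distribˡ-sum (p zero) (λ j → r (suc j) * z j)) ⟩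
  r zero * (- P) + sum (λ j → p zero * (r (suc j) * z j))
    ≡⟨ cong (λ q → r zero * (- P) + q) (sum-cong-≗ (λ j → swap (p zero) (r (suc j)) (z j))) ⟩
  r · backSubstitute p z ∎
  where
  open ≡-Reasoning
  R = (λ j → r (suc j)) · z
  P = (λ j → p (suc j)) · z
  split : ∀ a b c d e → (a * b - c * d) * e ≡ b * (a * e) + (- c) * (d * e)
  split = solve-∀
  regroup : ∀ a x c y → a * x + (- c) * y ≡ c * (- y) + a * x
  regroup = solve-∀
  swap : ∀ a b c → a * (b * c) ≡ b * (a * c)
  swap = solve-∀

eliminate-self : ∀ (p : Vector ℤ (suc m)) z → eliminate p p · z ≡ 0ℤ
eliminate-self {m} p z = trans (sum-cong-≗ (λ j → cancel (p (suc j)) (p zero) (z j))) (sum-replicate-zero m)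
  where
  cancel : ∀ a b c → (a * b - b * a) * c ≡ 0ℤ
  cancel = solve-∀

fewer-equations⇒nontrivial-solution : ∀ m (rows : List (Vector ℤ m)) → length rows < m →
  ∃[ y ] (∃[ i ] y i ≢ 0ℤ) × Solves rows y
fewer-equations⇒nontrivial-solution (suc m) rows len<1+m with pivoting rows
... | all-vanish vanish = e₀ , (zero , λ ()) , All.map (λ {r} → solves-e₀ {r}) vanish
  where
  e₀ : Vector ℤ (suc m)
  e₀ zero    = 1ℤ
  e₀ (suc _) = 0ℤ
  solves-e₀ : ∀ {r} → r zero ≡ 0ℤ → r · e₀ ≡ 0ℤ
  solves-e₀ {r} r₀≡0 = cong₂ _+_ (trans (ℤₚ.*-identityʳ (r zero)) r₀≡0)
    (trans (sum-cong-≗ (λ i → ℤₚ.*-zeroʳ (r (suc i)))) (sum-replicate-zero m))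
... | pivot p rest p₀≢0 len sound
  with fewer-equations⇒nontrivial-solution m (map (eliminate p) rest) fewer
  where
  fewer : length (map (eliminate p) rest) < m
  fewer = subst (_< m) (sym (length-map (eliminate p) rest))
                (ℕₚ.≤-pred (subst (_< suc m) len len<1+m))
...   | z , (j , zⱼ≢0) , z-solves =
  backSubstitute p z , (suc j , nonzero) , sound (backSubstitute p z) (solves-p ∷ solves-rest)
  where
  nonzero : p zero * z j ≢ 0ℤ
  nonzero eq with ℤₚ.i*j≡0⇒i≡0∨j≡0 (p zero) eq
  ... | inj₁ p₀≡0 = p₀≢0 p₀≡0
  ... | inj₂ zⱼ≡0 = zⱼ≢0 zⱼ≡0
  solves-p : p · backSubstitute p z ≡ 0ℤ
  solves-p = trans (sym (eliminate-· p p z)) (eliminate-self p z)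
  solves-rest : Solves rest (backSubstitute p z)
  solves-rest = All.map (λ {r} e → trans (sym (eliminate-· p r z)) e) (map⁻ z-solves)

IsBlock⁻ : ∀ {v} (P : PartitionSeq v) k 𝔅 B → IsBlock P k 𝔅 B ≡ true →
           ∣ B ∣ ≡ k × does (cls P k B ∈? 𝔅) ≡ true
IsBlock⁻ P k 𝔅 B isB with ∣ B ∣ ≡ᵇ k in ∣B∣≡k
... | true = ℕₚ.≡ᵇ⇒≡ ∣ B ∣ k (subst T (sym ∣B∣≡k) _) , isB

module DesignCounts (v : ℕ) (P : PartitionSeq v) (t k λ' : ℕ) (𝔅 : Subset (parts P k))
                    (design : IsDesign P t k λ' 𝔅) (t≤k : t ≤ k) (k≤v : k ≤ v) where

  isBlock : Subset v → Bool
  isBlock = IsBlock P k 𝔅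

  blocksThrough : Subset v → ℤ
  blocksThrough U = ∑ (λ B → 𝟙 (isBlock B) * 𝟙 (U ⊆ᵇ B))

  blocksThrough-t : ∀ X → ∣ X ∣ ≡ t → blocksThrough X ≡ + λ'
  blocksThrough-t X ∣X∣≡t = begin
    ∑ (λ B → 𝟙 (isBlock B) * 𝟙 (X ⊆ᵇ B))  ≡⟨ ∑-cong (λ B → sym (𝟙-∧ (isBlock B) (X ⊆ᵇ B))) ⟩
    ∑ (λ B → 𝟙 (isBlock B ∧ (X ⊆ᵇ B)))       ≡⟨ count≡∑ (λ B → isBlock B ∧ (X ⊆ᵇ B)) ⟨
    + count (λ B → isBlock B ∧ (X ⊆ᵇ B))     ≡⟨ cong +_ (design X ∣X∣≡t) ⟩
    + λ' ∎
    where open ≡-Reasoning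

  ∑-t-sets-through-blocks : ∀ (c : Subset v → ℤ) → (∀ Y → ∣ Y ∣ ≢ t → c Y ≡ 0ℤ) →
    + λ' * ∑ c ≡ ∑ (λ B → 𝟙 (isBlock B) * ∑ (λ Y → c Y * 𝟙 (Y ⊆ᵇ B)))
  ∑-t-sets-through-blocks c off = begin
    + λ' * ∑ c
      ≡⟨ *-distribˡ-∑ (+ λ') c ⟩
    ∑ (λ Y → + λ' * c Y)
      ≡⟨ ∑-cong through ⟩
    ∑ (λ Y → c Y * blocksThrough Y)
      ≡⟨ ∑-cong (λ Y → *-distribˡ-∑ (c Y) (λ B → 𝟙 (isBlock B) * 𝟙 (Y ⊆ᵇ B))) ⟩
    ∑ (λ Y → ∑ (λ B → c Y * (𝟙 (isBlock B) * 𝟙 (Y ⊆ᵇ B))))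
      ≡⟨ ∑-comm (λ Y B → c Y * (𝟙 (isBlock B) * 𝟙 (Y ⊆ᵇ B))) ⟩
    ∑ (λ B → ∑ (λ Y → c Y * (𝟙 (isBlock B) * 𝟙 (Y ⊆ᵇ B))))
      ≡⟨ ∑-cong (λ B → trans (∑-cong (λ Y → swap (c Y) (𝟙 (isBlock B)) (𝟙 (Y ⊆ᵇ B))))
                             (sym (*-distribˡ-∑ (𝟙 (isBlock B)) (λ Y → c Y * 𝟙 (Y ⊆ᵇ B))))) ⟩
    ∑ (λ B → 𝟙 (isBlock B) * ∑ (λ Y → c Y * 𝟙 (Y ⊆ᵇ B))) ∎
    where
    open ≡-Reasoning
    swap : ∀ a b d → a * (b * d) ≡ b * (a * d)
    swap = solve-∀
    through : ∀ Y → + λ' * c Y ≡ c Y * blocksThrough Y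
    through Y with ∣ Y ∣ ℕ.≟ t
    ... | yes ∣Y∣≡t = trans (ℤₚ.*-comm (+ λ') (c Y)) (cong (c Y *_) (sym (blocksThrough-t Y ∣Y∣≡t)))
    ... | no  ∣Y∣≢t rewrite off Y ∣Y∣≢t = ℤₚ.*-zeroʳ (+ λ')

  blocksThrough-double-count : ∀ U → ∣ U ∣ ≤ t →
    + λ' * + ((v ∸ ∣ U ∣) choose (t ∸ ∣ U ∣)) ≡ blocksThrough U * + ((k ∸ ∣ U ∣) choose (t ∸ ∣ U ∣))
  blocksThrough-double-count U ∣U∣≤t = begin
    + λ' * + ((v ∸ u) choose r)
      ≡⟨ cong (+ λ' *_) interval-in-V ⟨
    + λ' * ∑ c
      ≡⟨ ∑-t-sets-through-blocks c off ⟩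
    ∑ (λ B → 𝟙 (isBlock B) * ∑ (λ Y → c Y * 𝟙 (Y ⊆ᵇ B)))
      ≡⟨ ∑-cong interval-in-block ⟩
    ∑ (λ B → 𝟙 (isBlock B) * 𝟙 (U ⊆ᵇ B) * + ((k ∸ u) choose r))
      ≡⟨ *-distribʳ-∑ (+ ((k ∸ u) choose r)) (λ B → 𝟙 (isBlock B) * 𝟙 (U ⊆ᵇ B)) ⟨
    blocksThrough U * + ((k ∸ u) choose r) ∎
    where
    open ≡-Reasoning
    u = ∣ U ∣
    r = t ∸ u

    c : Subset v → ℤ
    c Y = 𝟙 (∣ Y ∣ ≡ᵇ u ℕ.+ r) * 𝟙 (U ⊆ᵇ Y)

    off : ∀ Y → ∣ Y ∣ ≢ t → c Y ≡ 0ℤ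
    off Y ∣Y∣≢t rewrite ℕₚ.m+[n∸m]≡n ∣U∣≤t | dec-false (∣ Y ∣ ℕ.≟ t) ∣Y∣≢t = refl

    interval : ∀ X → ∑ (λ Y → c Y * 𝟙 (Y ⊆ᵇ X)) ≡ 𝟙 (U ⊆ᵇ X) * + ((∣ X ∣ ∸ u) choose r)
    interval X = trans (∑-cong (λ Y → ℤₚ.*-assoc (𝟙 (∣ Y ∣ ≡ᵇ u ℕ.+ r)) (𝟙 (U ⊆ᵇ Y)) (𝟙 (Y ⊆ᵇ X))))
                       (∑-interval U X r)

    interval-in-V : ∑ c ≡ + ((v ∸ u) choose r)
    interval-in-V = begin
      ∑ c                                          ≡⟨ ∑-cong (λ Y → trans (cong (λ a → c Y * 𝟙 a) (⊆ᵇ-⊤ Y)) (ℤₚ.*-identityʳ (c Y))) ⟨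
      ∑ (λ Y → c Y * 𝟙 (Y ⊆ᵇ ⊤))                   ≡⟨ interval ⊤ ⟩
      𝟙 (U ⊆ᵇ ⊤) * + ((∣ ⊤ {v} ∣ ∸ u) choose r)    ≡⟨ cong₂ (λ a b → 𝟙 a * + ((b ∸ u) choose r)) (⊆ᵇ-⊤ U) (∣⊤∣≡n v) ⟩
      1ℤ * + ((v ∸ u) choose r)                    ≡⟨ ℤₚ.*-identityˡ _ ⟩
      + ((v ∸ u) choose r)                         ∎

    interval-in-block : ∀ B → 𝟙 (isBlock B) * ∑ (λ Y → c Y * 𝟙 (Y ⊆ᵇ B))
                            ≡ 𝟙 (isBlock B) * 𝟙 (U ⊆ᵇ B) * + ((k ∸ u) choose r)
    interval-in-block B with isBlock B in isB
    ... | false = refl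
    ... | true  = trans (cong (1ℤ *_) (trans (interval B)
                          (cong (λ b → 𝟙 (U ⊆ᵇ B) * + ((b ∸ u) choose r)) (proj₁ (IsBlock⁻ P k 𝔅 B isB)))))
                        (sym (ℤₚ.*-assoc 1ℤ (𝟙 (U ⊆ᵇ B)) _))

  blocksThrough-uniform : ∀ X Y → ∣ X ∣ ≡ ∣ Y ∣ → ∣ X ∣ ≤ t → blocksThrough X ≡ blocksThrough Y
  blocksThrough-uniform X Y ∣X∣≡∣Y∣ ∣X∣≤t =
    ℤₚ.*-cancelʳ-≡ (blocksThrough X) (blocksThrough Y) (+ c) {{ℤ.≢-nonZero c≢0}}
      (trans (sym (blocksThrough-double-count X ∣X∣≤t))
             (subst (λ y → + λ' * + ((v ∸ y) choose (t ∸ y)) ≡ blocksThrough Y * + ((k ∸ y) choose (t ∸ y)))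
                    (sym ∣X∣≡∣Y∣) (blocksThrough-double-count Y (subst (_≤ t) ∣X∣≡∣Y∣ ∣X∣≤t))))
    where
    c = (k ∸ ∣ X ∣) choose (t ∸ ∣ X ∣)
    c≢0 : + c ≢ 0ℤ
    c≢0 eq = ℕₚ.<-irrefl (sym (ℤₚ.+-injective eq)) (0<choose (k ∸ ∣ X ∣) (t ∸ ∣ X ∣) (ℕₚ.∸-monoˡ-≤ ∣ X ∣ t≤k))

  λᵢ : ℕ → ℤ
  λᵢ i = blocksThrough (keepFirst i ⊤)

  blocksThrough≡λᵢ : ∀ X → ∣ X ∣ ≤ t → blocksThrough X ≡ λᵢ ∣ X ∣
  blocksThrough≡λᵢ X ∣X∣≤t = blocksThrough-uniform X (keepFirst ∣ X ∣ ⊤)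
    (sym (∣keepFirst∣ ∣ X ∣ ⊤ (subst (∣ X ∣ ≤_) (sym (∣⊤∣≡n v)) (ℕₚ.≤-trans ∣X∣≤t (ℕₚ.≤-trans t≤k k≤v))))) ∣X∣≤t

  blocksAvoiding : Subset v → Subset v → ℤ
  blocksAvoiding X Z = ∑ (λ B → 𝟙 (isBlock B) * (𝟙 (X ⊆ᵇ B) * 𝟙 (Z ⊆ᵇ ∁ B)))

  0≤blocksAvoiding : ∀ X Z → 0ℤ ℤ.≤ blocksAvoiding X Z
  0≤blocksAvoiding X Z = 0≤∑ (λ B → 0≤* (0≤𝟙 (isBlock B)) (0≤* (0≤𝟙 (X ⊆ᵇ B)) (0≤𝟙 (Z ⊆ᵇ ∁ B))))

  blocksAvoiding-inclusion-exclusion : ∀ X Z →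
    blocksAvoiding X Z ≡ ∑ (λ L → 𝟙 (L ⊆ᵇ Z) * ((- 1ℤ) ^ ∣ L ∣ * blocksThrough (X ∪ L)))
  blocksAvoiding-inclusion-exclusion X Z = begin
    ∑ (λ B → 𝟙 (isBlock B) * (𝟙 (X ⊆ᵇ B) * 𝟙 (Z ⊆ᵇ ∁ B)))
      ≡⟨ ∑-cong (λ B → cong (λ a → 𝟙 (isBlock B) * (𝟙 (X ⊆ᵇ B) * a)) (∑-⊆-alternating Z B)) ⟨
    ∑ (λ B → 𝟙 (isBlock B) * (𝟙 (X ⊆ᵇ B) * ∑ (λ L → term L B)))
      ≡⟨ ∑-cong (λ B → trans (cong (𝟙 (isBlock B) *_) (*-distribˡ-∑ (𝟙 (X ⊆ᵇ B)) (λ L → term L B)))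
                             (*-distribˡ-∑ (𝟙 (isBlock B)) (λ L → 𝟙 (X ⊆ᵇ B) * term L B))) ⟩
    ∑ (λ B → ∑ (λ L → 𝟙 (isBlock B) * (𝟙 (X ⊆ᵇ B) * term L B)))
      ≡⟨ ∑-comm (λ B L → 𝟙 (isBlock B) * (𝟙 (X ⊆ᵇ B) * term L B)) ⟩
    ∑ (λ L → ∑ (λ B → 𝟙 (isBlock B) * (𝟙 (X ⊆ᵇ B) * term L B)))
      ≡⟨ ∑-cong (λ L → trans (∑-cong (λ B → factor-out L B))
                             (sym (*-distribˡ-∑ (𝟙 (L ⊆ᵇ Z) * (- 1ℤ) ^ ∣ L ∣) (λ B → 𝟙 (isBlock B) * 𝟙 (X ∪ L ⊆ᵇ B))))) ⟩
    ∑ (λ L → 𝟙 (L ⊆ᵇ Z) * (- 1ℤ) ^ ∣ L ∣ * blocksThrough (X ∪ L))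
      ≡⟨ ∑-cong (λ L → ℤₚ.*-assoc (𝟙 (L ⊆ᵇ Z)) ((- 1ℤ) ^ ∣ L ∣) (blocksThrough (X ∪ L))) ⟩
    ∑ (λ L → 𝟙 (L ⊆ᵇ Z) * ((- 1ℤ) ^ ∣ L ∣ * blocksThrough (X ∪ L))) ∎
    where
    open ≡-Reasoning
    term : Subset v → Subset v → ℤ
    term L B = 𝟙 (L ⊆ᵇ Z) * ((- 1ℤ) ^ ∣ L ∣ * 𝟙 (L ⊆ᵇ B))
    regroup : ∀ b x l s y → b * (x * (l * (s * y))) ≡ l * s * (b * (x * y))
    regroup = solve-∀
    factor-out : ∀ L B → 𝟙 (isBlock B) * (𝟙 (X ⊆ᵇ B) * term L B)
                       ≡ 𝟙 (L ⊆ᵇ Z) * (- 1ℤ) ^ ∣ L ∣ * (𝟙 (isBlock B) * 𝟙 (X ∪ L ⊆ᵇ B))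
    factor-out L B = trans (regroup (𝟙 (isBlock B)) (𝟙 (X ⊆ᵇ B)) (𝟙 (L ⊆ᵇ Z)) ((- 1ℤ) ^ ∣ L ∣) (𝟙 (L ⊆ᵇ B)))
      (cong (λ a → 𝟙 (L ⊆ᵇ Z) * (- 1ℤ) ^ ∣ L ∣ * (𝟙 (isBlock B) * a))
            (trans (sym (𝟙-∧ (X ⊆ᵇ B) (L ⊆ᵇ B))) (cong 𝟙 (sym (∪-⊆ᵇ X L B)))))

  blocksAvoiding-closed-form : ∀ X Z → X ⊆ᵇ ∁ Z ≡ true → ∣ X ∣ ℕ.+ ∣ Z ∣ ≤ t →
    blocksAvoiding X Z ≡ binomialTransform (λ l → (- 1ℤ) ^ l * λᵢ (∣ X ∣ ℕ.+ l)) ∣ Z ∣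
  blocksAvoiding-closed-form X Z X#Z ∣X∣+∣Z∣≤t = begin
    blocksAvoiding X Z
      ≡⟨ blocksAvoiding-inclusion-exclusion X Z ⟩
    ∑ (λ L → 𝟙 (L ⊆ᵇ Z) * ((- 1ℤ) ^ ∣ L ∣ * blocksThrough (X ∪ L)))
      ≡⟨ ∑-cong through-by-size ⟩
    ∑ (λ L → 𝟙 (L ⊆ᵇ Z) * ((- 1ℤ) ^ ∣ L ∣ * λᵢ (∣ X ∣ ℕ.+ ∣ L ∣)))
      ≡⟨ ∑-⊆-by-size Z (λ l → (- 1ℤ) ^ l * λᵢ (∣ X ∣ ℕ.+ l)) ⟩
    binomialTransform (λ l → (- 1ℤ) ^ l * λᵢ (∣ X ∣ ℕ.+ l)) ∣ Z ∣ ∎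
    where
    open ≡-Reasoning
    through-by-size : ∀ L → 𝟙 (L ⊆ᵇ Z) * ((- 1ℤ) ^ ∣ L ∣ * blocksThrough (X ∪ L))
                          ≡ 𝟙 (L ⊆ᵇ Z) * ((- 1ℤ) ^ ∣ L ∣ * λᵢ (∣ X ∣ ℕ.+ ∣ L ∣))
    through-by-size L with L ⊆ᵇ Z in L⊆Z
    ... | false = refl
    ... | true  = cong (λ a → 1ℤ * ((- 1ℤ) ^ ∣ L ∣ * a))
                       (trans (blocksThrough≡λᵢ (X ∪ L) (subst (_≤ t) (sym ∣X∪L∣) ∣X∣+∣L∣≤t)) (cong λᵢ ∣X∪L∣))
      where
      ∣X∪L∣ : ∣ X ∪ L ∣ ≡ ∣ X ∣ ℕ.+ ∣ L ∣
      ∣X∪L∣ = ∣∪∣-disjoint X L (⊆ᵇ∁-antitone X Z L X#Z L⊆Z)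
      ∣X∣+∣L∣≤t : ∣ X ∣ ℕ.+ ∣ L ∣ ≤ t
      ∣X∣+∣L∣≤t = ℕₚ.≤-trans (ℕₚ.+-monoʳ-≤ ∣ X ∣ (∣∣-mono L Z L⊆Z)) ∣X∣+∣Z∣≤t

  -- Sort the blocks through W by the part L of J that they miss.
  blocksThrough-by-trace : ∀ W J → blocksThrough W ≡ ∑ (λ L → 𝟙 (L ⊆ᵇ J) * blocksAvoiding (W ∪ (J ─ L)) L)
  blocksThrough-by-trace W J = begin
    ∑ (λ B → 𝟙 (isBlock B) * 𝟙 (W ⊆ᵇ B))
      ≡⟨ ∑-cong (λ B → trans (sym (ℤₚ.*-identityʳ _)) (cong (𝟙 (isBlock B) * 𝟙 (W ⊆ᵇ B) *_) (sym (∑-⊆-trace J B)))) ⟩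
    ∑ (λ B → 𝟙 (isBlock B) * 𝟙 (W ⊆ᵇ B) * ∑ (λ L → trace L B))
      ≡⟨ ∑-cong (λ B → *-distribˡ-∑ (𝟙 (isBlock B) * 𝟙 (W ⊆ᵇ B)) (λ L → trace L B)) ⟩
    ∑ (λ B → ∑ (λ L → 𝟙 (isBlock B) * 𝟙 (W ⊆ᵇ B) * trace L B))
      ≡⟨ ∑-comm (λ B L → 𝟙 (isBlock B) * 𝟙 (W ⊆ᵇ B) * trace L B) ⟩
    ∑ (λ L → ∑ (λ B → 𝟙 (isBlock B) * 𝟙 (W ⊆ᵇ B) * trace L B))
      ≡⟨ ∑-cong (λ L → trans (∑-cong (regroup L)) (sym (*-distribˡ-∑ (𝟙 (L ⊆ᵇ J)) (avoiding L)))) ⟩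
    ∑ (λ L → 𝟙 (L ⊆ᵇ J) * blocksAvoiding (W ∪ (J ─ L)) L) ∎
    where
    open ≡-Reasoning
    trace : Subset v → Subset v → ℤ
    trace L B = 𝟙 (L ⊆ᵇ J) * (𝟙 (J ─ L ⊆ᵇ B) * 𝟙 (L ⊆ᵇ ∁ B))
    avoiding : Subset v → Subset v → ℤ
    avoiding L B = 𝟙 (isBlock B) * (𝟙 (W ∪ (J ─ L) ⊆ᵇ B) * 𝟙 (L ⊆ᵇ ∁ B))
    shuffle : ∀ b w l d c → b * w * (l * (d * c)) ≡ l * (b * (w * d * c))
    shuffle = solve-∀
    regroup : ∀ L B → 𝟙 (isBlock B) * 𝟙 (W ⊆ᵇ B) * trace L B ≡ 𝟙 (L ⊆ᵇ J) * avoiding L B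
    regroup L B = trans (shuffle (𝟙 (isBlock B)) (𝟙 (W ⊆ᵇ B)) (𝟙 (L ⊆ᵇ J)) (𝟙 (J ─ L ⊆ᵇ B)) (𝟙 (L ⊆ᵇ ∁ B)))
      (cong (λ a → 𝟙 (L ⊆ᵇ J) * (𝟙 (isBlock B) * (a * 𝟙 (L ⊆ᵇ ∁ B))))
            (trans (sym (𝟙-∧ (W ⊆ᵇ B) (J ─ L ⊆ᵇ B))) (cong 𝟙 (sym (∪-⊆ᵇ W (J ─ L) B)))))

  module _ (s : ℕ) (s+s≤t : s ℕ.+ s ≤ t) where

    private
      s+s≤v : s ℕ.+ s ≤ v
      s+s≤v = ℕₚ.≤-trans s+s≤t (ℕₚ.≤-trans t≤k k≤v)

      Z₀ : Subset v
      Z₀ = keepFirst (s ℕ.+ s) ⊤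

      ∣Z₀∣ : ∣ Z₀ ∣ ≡ s ℕ.+ s
      ∣Z₀∣ = ∣keepFirst∣ (s ℕ.+ s) ⊤ (subst (s ℕ.+ s ≤_) (sym (∣⊤∣≡n v)) s+s≤v)

    -- Blocks containing a fixed (2s − i)-set and missing a fixed disjoint i-set.
    μ : ℕ → ℤ
    μ i = blocksAvoiding (Z₀ ─ keepFirst i Z₀) (keepFirst i Z₀)

    0≤μ : ∀ i → 0ℤ ℤ.≤ μ i
    0≤μ i = 0≤blocksAvoiding (Z₀ ─ keepFirst i Z₀) (keepFirst i Z₀)

    blocksAvoiding≡μ : ∀ X Z → X ⊆ᵇ ∁ Z ≡ true → ∣ X ∣ ℕ.+ ∣ Z ∣ ≡ s ℕ.+ s → blocksAvoiding X Z ≡ μ ∣ Z ∣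
    blocksAvoiding≡μ X Z X#Z ∣X∣+∣Z∣≡2s =
      trans (blocksAvoiding-closed-form X Z X#Z (subst (_≤ t) (sym ∣X∣+∣Z∣≡2s) s+s≤t))
            (sym (trans (blocksAvoiding-closed-form (Z₀ ─ Zᵢ) Zᵢ (─-⊆ᵇ∁ Z₀ Zᵢ) (subst (_≤ t) (sym ∣Z₀─Zᵢ∣+∣Zᵢ∣) s+s≤t))
                        (cong₂ (λ a b → binomialTransform (λ l → (- 1ℤ) ^ l * λᵢ (a ℕ.+ l)) b) ∣Z₀─Zᵢ∣ ∣Zᵢ∣)))
      where
      Zᵢ = keepFirst ∣ Z ∣ Z₀
      ∣Zᵢ∣ : ∣ Zᵢ ∣ ≡ ∣ Z ∣
      ∣Zᵢ∣ = ∣keepFirst∣ ∣ Z ∣ Z₀ (subst (∣ Z ∣ ≤_) (sym (trans ∣Z₀∣ (sym ∣X∣+∣Z∣≡2s))) (ℕₚ.m≤n+m ∣ Z ∣ ∣ X ∣))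
      ∣Z₀─Zᵢ∣+∣Zᵢ∣ : ∣ Z₀ ─ Zᵢ ∣ ℕ.+ ∣ Zᵢ ∣ ≡ s ℕ.+ s
      ∣Z₀─Zᵢ∣+∣Zᵢ∣ = trans (∣─∣+∣∣ Z₀ Zᵢ (keepFirst-⊆ᵇ ∣ Z ∣ Z₀)) ∣Z₀∣
      ∣Z₀─Zᵢ∣ : ∣ Z₀ ─ Zᵢ ∣ ≡ ∣ X ∣
      ∣Z₀─Zᵢ∣ = ℕₚ.+-cancelʳ-≡ _ _ _ (trans ∣Z₀─Zᵢ∣+∣Zᵢ∣ (trans (sym ∣X∣+∣Z∣≡2s) (cong (∣ X ∣ ℕ.+_) (sym ∣Zᵢ∣))))

    blocksThrough-∪ : ∀ S S' → ∣ S ∣ ≡ s → ∣ S' ∣ ≡ s → blocksThrough (S ∪ S') ≡ binomialTransform μ ∣ S ∩ S' ∣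
    blocksThrough-∪ S S' ∣S∣≡s ∣S'∣≡s = begin
      blocksThrough W
        ≡⟨ blocksThrough-by-trace W J ⟩
      ∑ (λ L → 𝟙 (L ⊆ᵇ J) * blocksAvoiding (W ∪ (J ─ L)) L)
        ≡⟨ ∑-cong avoiding-by-size ⟩
      ∑ (λ L → 𝟙 (L ⊆ᵇ J) * μ ∣ L ∣)
        ≡⟨ ∑-⊆-by-size J μ ⟩
      binomialTransform μ ∣ J ∣
        ≡⟨ cong (binomialTransform μ) ∣J∣ ⟩
      binomialTransform μ j ∎
      where
      open ≡-Reasoning
      W = S ∪ S'
      j = ∣ S ∩ S' ∣
      ∣W∣+j : ∣ W ∣ ℕ.+ j ≡ s ℕ.+ s
      ∣W∣+j = trans (∣∪∣+∣∩∣ S S') (cong₂ ℕ._+_ ∣S∣≡s ∣S'∣≡s)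
      J = keepFirst j (∁ W)
      ∣J∣ : ∣ J ∣ ≡ j
      ∣J∣ = ∣keepFirst∣ j (∁ W) (subst (j ≤_) (sym (∣∁p∣≡n∸∣p∣ W))
              (ℕₚ.m+n≤o⇒m≤o∸n j (subst (_≤ v) (trans (sym ∣W∣+j) (ℕₚ.+-comm ∣ W ∣ j)) s+s≤v)))
      W#J : W ⊆ᵇ ∁ J ≡ true
      W#J = ⊆ᵇ∁-sym J W (keepFirst-⊆ᵇ j (∁ W))

      avoiding-by-size : ∀ L → 𝟙 (L ⊆ᵇ J) * blocksAvoiding (W ∪ (J ─ L)) L ≡ 𝟙 (L ⊆ᵇ J) * μ ∣ L ∣
      avoiding-by-size L with L ⊆ᵇ J in L⊆J
      ... | false = refl
      ... | true  = cong (1ℤ *_) (blocksAvoiding≡μ (W ∪ (J ─ L)) L disjoint size)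
        where
        disjoint : W ∪ (J ─ L) ⊆ᵇ ∁ L ≡ true
        disjoint = trans (∪-⊆ᵇ W (J ─ L) (∁ L))
                         (cong₂ _∧_ (⊆ᵇ∁-antitone W J L W#J L⊆J) (─-⊆ᵇ∁ J L))
        size : ∣ W ∪ (J ─ L) ∣ ℕ.+ ∣ L ∣ ≡ s ℕ.+ s
        size = begin
          ∣ W ∪ (J ─ L) ∣ ℕ.+ ∣ L ∣
            ≡⟨ cong (ℕ._+ ∣ L ∣) (∣∪∣-disjoint W (J ─ L) (⊆ᵇ∁-antitone W J (J ─ L) W#J (─-⊆ᵇ J L))) ⟩
          ∣ W ∣ ℕ.+ ∣ J ─ L ∣ ℕ.+ ∣ L ∣
            ≡⟨ ℕₚ.+-assoc ∣ W ∣ _ _ ⟩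
          ∣ W ∣ ℕ.+ (∣ J ─ L ∣ ℕ.+ ∣ L ∣)
            ≡⟨ cong (∣ W ∣ ℕ.+_) (trans (∣─∣+∣∣ J L L⊆J) ∣J∣) ⟩
          ∣ W ∣ ℕ.+ j
            ≡⟨ ∣W∣+j ⟩
          s ℕ.+ s ∎

    μ-positive : ∀ B₀ → isBlock B₀ ≡ true → s ≤ v ∸ k → 0ℤ ℤ.< μ s
    μ-positive B₀ isB₀ s≤v∸k = subst (0ℤ ℤ.<_) (trans (blocksAvoiding≡μ X Z X#Z (cong₂ ℕ._+_ ∣X∣ ∣Z∣)) (cong μ ∣Z∣))
      (ℤₚ.<-≤-trans (ℤ.+<+ (s≤s z≤n))
        (subst (ℤ._≤ blocksAvoiding X Z) B₀-counted (≤∑ (λ B → 0≤* (0≤𝟙 (isBlock B)) (0≤* (0≤𝟙 (X ⊆ᵇ B)) (0≤𝟙 (Z ⊆ᵇ ∁ B)))) B₀)))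
      where
      ∣B₀∣ = proj₁ (IsBlock⁻ P k 𝔅 B₀ isB₀)
      X = keepFirst s B₀
      Z = keepFirst s (∁ B₀)
      ∣X∣ : ∣ X ∣ ≡ s
      ∣X∣ = ∣keepFirst∣ s B₀ (subst (s ≤_) (sym ∣B₀∣) (ℕₚ.≤-trans (ℕₚ.m+n≤o⇒m≤o s s+s≤t) t≤k))
      ∣Z∣ : ∣ Z ∣ ≡ s
      ∣Z∣ = ∣keepFirst∣ s (∁ B₀) (subst (s ≤_) (sym (trans (∣∁p∣≡n∸∣p∣ B₀) (cong (v ∸_) ∣B₀∣))) s≤v∸k)
      X#Z : X ⊆ᵇ ∁ Z ≡ true
      X#Z = ⊆ᵇ-trans X B₀ (∁ Z) (keepFirst-⊆ᵇ s B₀) (⊆ᵇ∁-sym Z B₀ (keepFirst-⊆ᵇ s (∁ B₀)))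
      B₀-counted : 𝟙 (isBlock B₀) * (𝟙 (X ⊆ᵇ B₀) * 𝟙 (Z ⊆ᵇ ∁ B₀)) ≡ 1ℤ
      B₀-counted rewrite isB₀ | keepFirst-⊆ᵇ s B₀ | keepFirst-⊆ᵇ s (∁ B₀) = refl

    blocks-through-pair : ∀ S S' → ∣ S ∣ ≡ s → ∣ S' ∣ ≡ s →
      ∑ (λ B → 𝟙 (isBlock B) * (𝟙 (S ⊆ᵇ B) * 𝟙 (S' ⊆ᵇ B))) ≡ ∑ (λ I → μ ∣ I ∣ * (𝟙 (I ⊆ᵇ S) * 𝟙 (I ⊆ᵇ S')))
    blocks-through-pair S S' ∣S∣≡s ∣S'∣≡s = begin
      ∑ (λ B → 𝟙 (isBlock B) * (𝟙 (S ⊆ᵇ B) * 𝟙 (S' ⊆ᵇ B)))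
        ≡⟨ ∑-cong (λ B → cong (𝟙 (isBlock B) *_) (trans (sym (𝟙-∧ (S ⊆ᵇ B) (S' ⊆ᵇ B))) (cong 𝟙 (sym (∪-⊆ᵇ S S' B))))) ⟩
      blocksThrough (S ∪ S')
        ≡⟨ blocksThrough-∪ S S' ∣S∣≡s ∣S'∣≡s ⟩
      binomialTransform μ ∣ S ∩ S' ∣
        ≡⟨ ∑-⊆-by-size (S ∩ S') μ ⟨
      ∑ (λ I → 𝟙 (I ⊆ᵇ S ∩ S') * μ ∣ I ∣)
        ≡⟨ ∑-cong (λ I → trans (ℤₚ.*-comm _ (μ ∣ I ∣))
                               (cong (μ ∣ I ∣ *_) (trans (cong 𝟙 (⊆ᵇ-∩ I S S')) (𝟙-∧ (I ⊆ᵇ S) (I ⊆ᵇ S'))))) ⟩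
      ∑ (λ I → μ ∣ I ∣ * (𝟙 (I ⊆ᵇ S) * 𝟙 (I ⊆ᵇ S'))) ∎
      where open ≡-Reasoning

    ∑-block-squares : ∀ (f : Subset v → ℤ) → (∀ S → ∣ S ∣ ≢ s → f S ≡ 0ℤ) →
      ∑ (λ B → 𝟙 (isBlock B) * (∑ (λ S → 𝟙 (S ⊆ᵇ B) * f S) * ∑ (λ S → 𝟙 (S ⊆ᵇ B) * f S)))
      ≡ ∑ (λ I → μ ∣ I ∣ * (∑ (λ S → 𝟙 (I ⊆ᵇ S) * f S) * ∑ (λ S → 𝟙 (I ⊆ᵇ S) * f S)))
    ∑-block-squares f off = begin
      ∑ (λ B → 𝟙 (isBlock B) * (∑ (λ S → 𝟙 (S ⊆ᵇ B) * f S) * ∑ (λ S → 𝟙 (S ⊆ᵇ B) * f S)))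
        ≡⟨ ∑-weighted-squares (𝟙 ∘ isBlock) (λ B S → 𝟙 (S ⊆ᵇ B)) f ⟩
      ∑ (λ S → ∑ (λ S' → f S * f S' * ∑ (λ B → 𝟙 (isBlock B) * (𝟙 (S ⊆ᵇ B) * 𝟙 (S' ⊆ᵇ B)))))
        ≡⟨ ∑-cong (λ S → ∑-cong (λ S' → pair S S')) ⟩
      ∑ (λ S → ∑ (λ S' → f S * f S' * ∑ (λ I → μ ∣ I ∣ * (𝟙 (I ⊆ᵇ S) * 𝟙 (I ⊆ᵇ S')))))
        ≡⟨ ∑-weighted-squares (μ ∘ ∣_∣) (λ I S → 𝟙 (I ⊆ᵇ S)) f ⟨
      ∑ (λ I → μ ∣ I ∣ * (∑ (λ S → 𝟙 (I ⊆ᵇ S) * f S) * ∑ (λ S → 𝟙 (I ⊆ᵇ S) * f S))) ∎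
      where
      open ≡-Reasoning
      pair : ∀ S S' → f S * f S' * ∑ (λ B → 𝟙 (isBlock B) * (𝟙 (S ⊆ᵇ B) * 𝟙 (S' ⊆ᵇ B)))
                    ≡ f S * f S' * ∑ (λ I → μ ∣ I ∣ * (𝟙 (I ⊆ᵇ S) * 𝟙 (I ⊆ᵇ S')))
      pair S S' with ∣ S ∣ ℕ.≟ s | ∣ S' ∣ ℕ.≟ s
      ... | yes ∣S∣≡s | yes ∣S'∣≡s = cong (f S * f S' *_) (blocks-through-pair S S' ∣S∣≡s ∣S'∣≡s)
      ... | no  ∣S∣≢s | _          rewrite off S ∣S∣≢s = refl
      ... | yes _     | no ∣S'∣≢s  rewrite off S' ∣S'∣≢s | ℤₚ.*-zeroʳ (f S) = refl

    block-sums-vanish⇒zero : ∀ B₀ → isBlock B₀ ≡ true → s ≤ v ∸ k →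
      ∀ (f : Subset v → ℤ) → (∀ S → ∣ S ∣ ≢ s → f S ≡ 0ℤ) →
      (∀ B → isBlock B ≡ true → ∑ (λ S → 𝟙 (S ⊆ᵇ B) * f S) ≡ 0ℤ) → ∀ I → f I ≡ 0ℤ
    block-sums-vanish⇒zero B₀ isB₀ s≤v∸k f off vanish I with ∣ I ∣ ℕ.≟ s
    ... | no  ∣I∣≢s = off I ∣I∣≢s
    ... | yes ∣I∣≡s = i*[j*j]≡0⇒j≡0 (ℤₚ.<⇒≢ (μ-positive B₀ isB₀ s≤v∸k) ∘ sym) (begin
      μ s * (f I * f I)            ≡⟨ cong (λ i → μ i * (f I * f I)) ∣I∣≡s ⟨
      μ ∣ I ∣ * (f I * f I)        ≡⟨ cong (λ a → μ ∣ I ∣ * (a * a)) (∑-⊇-concentrated f off I ∣I∣≡s) ⟨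
      μ ∣ I ∣ * (h I * h I)        ≡⟨ ∑≡0⇒≡0 (λ J → 0≤* (0≤μ ∣ J ∣) (0≤i*i (h J))) squares-vanish I ⟩
      0ℤ ∎)
      where
      open ≡-Reasoning
      g h : Subset v → ℤ
      g B = ∑ (λ S → 𝟙 (S ⊆ᵇ B) * f S)
      h J = ∑ (λ S → 𝟙 (J ⊆ᵇ S) * f S)
      on-block : ∀ B → 𝟙 (isBlock B) * (g B * g B) ≡ 0ℤ
      on-block B with isBlock B in isB
      ... | false = refl
      ... | true  rewrite vanish B isB = refl
      squares-vanish : ∑ (λ J → μ ∣ J ∣ * (h J * h J)) ≡ 0ℤ
      squares-vanish = trans (sym (∑-block-squares f off)) (∑-zero on-block)

members : Subset n → List (Fin n)
members []            = []
members (inside  ∷ p) = zero ∷ map suc (members p)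
members (outside ∷ p) = map suc (members p)

length-members : (p : Subset n) → length (members p) ≡ ∣ p ∣
length-members []            = refl
length-members (inside  ∷ p) = cong suc (trans (length-map suc (members p)) (length-members p))
length-members (outside ∷ p) = trans (length-map suc (members p)) (length-members p)

∈-members : (p : Subset n) (i : Fin n) → does (i ∈? p) ≡ true → i ∈ members p
∈-members (inside  ∷ p) zero    _   = here refl
∈-members (inside  ∷ p) (suc i) i∈p = there (∈-map⁺ suc (∈-members p i i∈p))
∈-members (outside ∷ p) (suc i) i∈p = ∈-map⁺ suc (∈-members p i i∈p)

select : ∀ {m} (j : Fin m) (y : Vector ℤ m) → sum (λ i → 𝟙 (does (j Fin.≟ i)) * y i) ≡ y j
select {suc m} zero    y = trans (cong (λ r → 1ℤ * y zero + r) (sum-replicate-zero m))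
                                 (trans (ℤₚ.+-identityʳ _) (ℤₚ.*-identityˡ (y zero)))
select {suc m} (suc j) y = trans (ℤₚ.+-identityˡ _) (select j (λ i → y (suc i)))

module _ {v : ℕ} (P : PartitionSeq v) (x : ℕ) where

  classFunction : Vector ℤ (parts P x) → Subset v → ℤ
  classFunction y S = 𝟙 (∣ S ∣ ≡ᵇ x) * y (cls P x S)

  ∑-classFunction : ∀ y B → ∑ (λ S → 𝟙 (S ⊆ᵇ B) * classFunction y S) ≡ (λ i → + downCount P x i B) · y
  ∑-classFunction y B = begin
    ∑ (λ S → 𝟙 (S ⊆ᵇ B) * classFunction y S)
      ≡⟨ ∑-cong expand ⟩
    ∑ (λ S → sum (λ i → 𝟙 (counted S i) * y i))
      ≡⟨ ∑-sum-comm (λ S i → 𝟙 (counted S i) * y i) ⟩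
    sum (λ i → ∑ (λ S → 𝟙 (counted S i) * y i))
      ≡⟨ sum-cong-≗ (λ i → trans (sym (*-distribʳ-∑ (y i) (λ S → 𝟙 (counted S i))))
                                 (cong (_* y i) (sym (count≡∑ (λ S → counted S i))))) ⟩
    sum (λ i → + downCount P x i B * y i) ∎
    where
    open ≡-Reasoning
    counted : Subset v → Fin (parts P x) → Bool
    counted S i = (∣ S ∣ ≡ᵇ x) ∧ (does (cls P x S Fin.≟ i) ∧ (S ⊆ᵇ B))
    regroup : ∀ a b c d → a * (b * (c * d)) ≡ b * (c * a) * d
    regroup = solve-∀
    expand : ∀ S → 𝟙 (S ⊆ᵇ B) * classFunction y S ≡ sum (λ i → 𝟙 (counted S i) * y i)
    expand S = begin
      𝟙 (S ⊆ᵇ B) * (𝟙 (∣ S ∣ ≡ᵇ x) * y (cls P x S))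
        ≡⟨ cong (λ r → 𝟙 (S ⊆ᵇ B) * (𝟙 (∣ S ∣ ≡ᵇ x) * r)) (select (cls P x S) y) ⟨
      𝟙 (S ⊆ᵇ B) * (𝟙 (∣ S ∣ ≡ᵇ x) * sum (λ i → 𝟙 (does (cls P x S Fin.≟ i)) * y i))
        ≡⟨ cong (𝟙 (S ⊆ᵇ B) *_) (*-distribˡ-sum (𝟙 (∣ S ∣ ≡ᵇ x)) (λ i → 𝟙 (does (cls P x S Fin.≟ i)) * y i)) ⟩
      𝟙 (S ⊆ᵇ B) * sum (λ i → 𝟙 (∣ S ∣ ≡ᵇ x) * (𝟙 (does (cls P x S Fin.≟ i)) * y i))
        ≡⟨ *-distribˡ-sum (𝟙 (S ⊆ᵇ B)) (λ i → 𝟙 (∣ S ∣ ≡ᵇ x) * (𝟙 (does (cls P x S Fin.≟ i)) * y i)) ⟩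
      sum (λ i → 𝟙 (S ⊆ᵇ B) * (𝟙 (∣ S ∣ ≡ᵇ x) * (𝟙 (does (cls P x S Fin.≟ i)) * y i)))
        ≡⟨ sum-cong-≗ (λ i → trans (regroup (𝟙 (S ⊆ᵇ B)) (𝟙 (∣ S ∣ ≡ᵇ x)) (𝟙 (does (cls P x S Fin.≟ i))) (y i))
             (cong (_* y i) (sym (trans (𝟙-∧ (∣ S ∣ ≡ᵇ x) _) (cong (𝟙 (∣ S ∣ ≡ᵇ x) *_) (𝟙-∧ _ (S ⊆ᵇ B))))))) ⟩
      sum (λ i → 𝟙 (counted S i) * y i) ∎

  classFunction-off : ∀ y S → ∣ S ∣ ≢ x → classFunction y S ≡ 0ℤ
  classFunction-off y S ∣S∣≢x rewrite dec-false (∣ S ∣ ℕ.≟ x) ∣S∣≢x = refl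

  classFunction-on : ∀ y S → ∣ S ∣ ≡ x → classFunction y S ≡ y (cls P x S)
  classFunction-on y S ∣S∣≡x rewrite dec-true (∣ S ∣ ℕ.≟ x) ∣S∣≡x = ℤₚ.*-identityˡ _

module _ {v : ℕ} (P : PartitionSeq v) (tactical : Tactical P) (x k : ℕ) (x≤k : x ≤ k) (k≤v : k ≤ v)
         (𝔅 : Subset (parts P k)) where

  representative : Fin (parts P k) → Subset v
  representative b = proj₁ (surj P k k≤v b)

  blockEquations : List (Vector ℤ (parts P x))
  blockEquations = map (λ b i → + downCount P x i (representative b)) (members 𝔅)

  length-blockEquations : length blockEquations ≡ ∣ 𝔅 ∣
  length-blockEquations = trans (length-map _ (members 𝔅)) (length-members 𝔅)

  block-sums-vanish : ∀ y → Solves blockEquations y → ∀ B → IsBlock P k 𝔅 B ≡ true →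
                      ∑ (λ S → 𝟙 (S ⊆ᵇ B) * classFunction P x y S) ≡ 0ℤ
  block-sums-vanish y solves B isB = begin
    ∑ (λ S → 𝟙 (S ⊆ᵇ B) * classFunction P x y S)
      ≡⟨ ∑-classFunction P x y B ⟩
    (λ i → + downCount P x i B) · y
      ≡⟨ sum-cong-≗ (λ i → cong (λ c → + c * y i)
           (Tactical.down tactical x k x≤k k≤v i b B (representative b) ∣B∣≡k ∣rep∣≡k refl cls-rep)) ⟩
    (λ i → + downCount P x i (representative b)) · y
      ≡⟨ All.lookup (map⁻ solves) (∈-members 𝔅 b b∈𝔅) ⟩
    0ℤ ∎
    where
    open ≡-Reasoning
    b = cls P k B
    ∣B∣≡k = proj₁ (IsBlock⁻ P k 𝔅 B isB)
    b∈𝔅 = proj₂ (IsBlock⁻ P k 𝔅 B isB)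
    ∣rep∣≡k = proj₁ (proj₂ (surj P k k≤v b))
    cls-rep = proj₂ (proj₂ (surj P k k≤v b))

x≤t/2⇒x+x≤t : ∀ {x t} → x ≤ t / 2 → x ℕ.+ x ≤ t
x≤t/2⇒x+x≤t {x} {t} x≤t/2 = begin
  x ℕ.+ x       ≡⟨ cong (x ℕ.+_) (ℕₚ.+-identityʳ x) ⟨
  2 ℕ.* x       ≡⟨ ℕₚ.*-comm 2 x ⟩
  x ℕ.* 2       ≤⟨ ℕₚ.*-monoˡ-≤ 2 x≤t/2 ⟩
  t / 2 ℕ.* 2   ≤⟨ m/n*n≤m t 2 ⟩
  t             ∎
  where open ℕₚ.≤-Reasoning

k≤v∸t⇒t≤v∸k : ∀ {k t v} → t ≤ v → k ≤ v ∸ t → t ≤ v ∸ k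
k≤v∸t⇒t≤v∸k {k} {t} {v} t≤v k≤v∸t =
  ℕₚ.m+n≤o⇒m≤o∸n t (subst (_≤ v) (ℕₚ.+-comm k t) (ℕₚ.m≤o∸n⇒m+n≤o k t≤v k≤v∸t))

theorem3p19 : (v : ℕ) (P : PartitionSeq v) → Tactical P →
    (t k λ' : ℕ) (𝔅 : Subset (parts P k)) →
    IsDesign P t k λ' 𝔅 →
    (∃ λ (B : Subset v) → T (IsBlock P k 𝔅 B)) →
    t ≤ k → k ≤ v ∸ t →
    (x : ℕ) → x ≤ t / 2 → parts P x ≤ ∣ 𝔅 ∣
theorem3p19 v P tactical t k λ' 𝔅 design (B₀ , B₀-block) t≤k k≤v∸t x x≤t/2 = ℕₚ.≮⇒≥ fewer-blocks-impossible
  where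
  k≤v = ℕₚ.≤-trans k≤v∸t (ℕₚ.m∸n≤m v t)
  x+x≤t = x≤t/2⇒x+x≤t x≤t/2
  x≤k = ℕₚ.≤-trans (ℕₚ.m+n≤o⇒m≤o x x+x≤t) t≤k
  x≤v∸k = ℕₚ.≤-trans (ℕₚ.m+n≤o⇒m≤o x x+x≤t) (k≤v∸t⇒t≤v∸k (ℕₚ.≤-trans t≤k k≤v) k≤v∸t)
  fewer-blocks-impossible : ¬ ∣ 𝔅 ∣ < parts P x
  fewer-blocks-impossible ∣𝔅∣<#𝔓ₓ
    with fewer-equations⇒nontrivial-solution (parts P x) (blockEquations P tactical x k x≤k k≤v 𝔅)
           (subst (_< parts P x) (sym (length-blockEquations P tactical x k x≤k k≤v 𝔅)) ∣𝔅∣<#𝔓ₓ)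
  ... | y , (i₀ , yᵢ₀≢0) , solves with surj P x (ℕₚ.≤-trans x≤k k≤v) i₀
  ...   | I₀ , ∣I₀∣≡x , cls-I₀ = yᵢ₀≢0 (begin
    y i₀                    ≡⟨ cong y cls-I₀ ⟨
    y (cls P x I₀)          ≡⟨ classFunction-on P x y I₀ ∣I₀∣≡x ⟨
    classFunction P x y I₀  ≡⟨ DesignCounts.block-sums-vanish⇒zero v P t k λ' 𝔅 design t≤k k≤v x x+x≤t
                                 B₀ (Equivalence.to T-≡ B₀-block) x≤v∸k (classFunction P x y)
                                 (classFunction-off P x y)
                                 (block-sums-vanish P tactical x k x≤k k≤v 𝔅 y solves) I₀ ⟩
    0ℤ                      ∎)
    where open ≡-Reasoning
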